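{- For all $n\in\mathbb{N}$ with $n\ge1$ and all $X\in\mathrm{IS}$: if $X\in\mathcal{E}_n$, then $X$ computes $\mathrm{tstnz}_n$.
   Context: Basic instructions: $\mathtt{in}{:}i.\mathtt{get}$ ($i\ge1$), $\mathtt{out}.\mathtt{set}{:}b$ ($b\in\{0,1\}$), $\mathtt{aux}{:}i.\mathtt{get}$ ($i\ge1$), $\mathtt{aux}{:}i.\mathtt{set}{:}b$ ($i\ge1$, $b\in\{0,1\}$). The part before the dot names a Boolean register ($\mathtt{in}{:}i$ input, $\mathtt{out}$ output, $\mathtt{aux}{:}i$ auxiliary); $\mathtt{get}$ changes nothing and replies the content, $\mathtt{set}{:}b$ makes the content $b$ and replies $b$. Primitive instructions: for each basic instruction $a$, plain $a$, positive test $+a$, negative test $-a$; forward jumps $\#l$ ($l\in\mathbb{N}$); termination $!$. $\mathrm{IS}$ is the set of finite sequences $X=u_1;\dots;u_k$ of primitive instructions, $\mathrm{len}(X)=k$. Execution starts at $u_1$: plain $a$ executes $a$ and proceeds with the next instruction; $+a$ executes $a$ and proceeds with the next instruction if the reply is $1$, otherwise skips the next one and proceeds with the one after it; $-a$ likewise with replies reversed; $\#l$ proceeds with the $l$-th next instruction; $!$ terminates. If $l=0$ or there is no instruction to proceed with, execution never terminates. For $f:\{0,1\}^n\to\{0,1\}$, $X$ computes $f$ if there is $k$ such that for all $b_1,\dots,b_n$, executing $X$ with $\mathtt{in}{:}i$ initially $b_i$, $\mathtt{out}$ and $\mathtt{aux}{:}1,\dots,\mathtt{aux}{:}k$ initially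 $0$ (other registers arbitrary) terminates with final content of $\mathtt{out}$ equal to $f(b_1,\dots,b_n)$. $\mathrm{tstnz}_n(b_1,\dots,b_n)=1$ iff some $b_i=1$. Read instructions are $+\mathtt{in}{:}i.\mathtt{get}$ and $-\mathtt{in}{:}i.\mathtt{get}$; such an instruction reads $\mathtt{in}{:}i$; an input register is read $t$ times in $X$ if it is read by exactly $t$ occurrences of read instructions in $X$. Notation: $;_{i=p}^{q}P_i$ denotes $P_p;\dots;P_q$ (empty if $p>q$); write $r_i$ for $\mathtt{in}{:}i.\mathtt{get}$. The set $\mathcal{C}_n$: for even $n$, $X\in\mathcal{C}_n$ iff $X={;}_{i=1}^{n/2}\big(-r_{\rho(2i-1)};+r_{\rho(2i)};\varphi(i)\big);!$ for some bijection $\rho$ of $\{1,\dots,n\}$ and function $\varphi$ on $\{1,\dots,n/2\}$ with $\varphi(j)\in\{\#3k: k\ge1, k\le n/2-j\}\cup\{\mathtt{out}.\mathtt{set}{:}1,+\mathtt{out}.\mathtt{set}{:}1,-\mathtt{out}.\mathtt{set}{:}1\}$ for all $j$ and $\varphi(n/2)\in\{\mathtt{out}.\mathtt{set}{:}1,+\mathtt{out}.\mathtt{set}{:}1\}$; for odd $n$, $X\in\mathcal{C}_n$ iff there are $m\in\mathbb{N}$ with $m\le(n-1)/2$, a bijection $\rho$ of $\{1,\dots,n\}$ and $\varphi$ on $\{1,\dots,(n+1)/2\}$ with $X={;}_{i=1}^{m}\big(-r_{\rho(2i-1)};+r_{\rho(2i)};\varphi(i)\big);+r_{\rho(2m+1)};\varphi(m+1);{;}_{i=m+1}^{(n-1)/2}\big(-r_{\rho(2i)};+r_{\rho(2i+1)};\varphi(i+1)\big);!$,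 where $\varphi(j)\in\{\#(3k-1): k\ge1, k\le(n+1)/2-j, j\le m<j+k\}\cup\{\#3k: k\ge1, k\le(n+1)/2-j, \text{not }(j\le m<j+k)\}\cup\{\mathtt{out}.\mathtt{set}{:}1,+\mathtt{out}.\mathtt{set}{:}1,-\mathtt{out}.\mathtt{set}{:}1\}$ for all $j$ and $\varphi((n+1)/2)\in\{\mathtt{out}.\mathtt{set}{:}1,+\mathtt{out}.\mathtt{set}{:}1\}$. A chain of zero or more forward jumps in $X$ beginning at position $p$ leads to position $q$ if there are positions $p=p_0,p_1,\dots,p_s=q$ ($s\ge0$) such that for each $t<s$ the $p_t$-th instruction of $X$ is $\#l_t$ with $l_t\ge1$ and $p_{t+1}=p_t+l_t$. The set $\mathcal{E}_n\subseteq\mathrm{IS}$: if no input register is read more than once in $X$, then $X\in\mathcal{E}_n$ iff $X\in\mathcal{C}_n$; if at least two input registers are read more than once in $X$, or some input register is read more than twice in $X$, then $X\notin\mathcal{E}_n$; if exactly one input register is read more than once in $X$ and it is read exactly twice, then $X\in\mathcal{E}_n$ iff, for positions $k\neq l$ such that the $k$-th and $l$-th primitive instructions of $X$ read that same input register: (a) no chain of zero or more forward jumps in $X$ beginning at a position $\le k+2$ leads to position $l$; (b) the $l$-th primitive instruction of $X$ is $+\mathtt{in}{:}i.\mathtt{get}$ for some $i\le n$; (c) the sequence obtained from $X$ by replacing its $l$-th primitive instruction by $\#2$ belongs to $\mathcal{C}_n$. -}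

module Defs where

open import Data.Nat using (ℕ; zero; suc; _+_; _*_; _∸_; _≤_; _<_; _≡ᵇ_)
open import Data.Bool using (Bool; true; false; _∨_; if_then_else_)
open import Data.Fin using (Fin; toℕ)
import Data.Fin as F
open import Data.List using (List; []; _∷_; _++_; concatMap; applyUpTo)
open import Data.List.Relation.Unary.All using (All)
open import Data.Maybe using (Maybe; just; nothing)
open import Data.Product using (Σ; ∃; _×_; _,_)
open import Data.Sum using (_⊎_)
open import Relation.Binary.PropositionalEquality using (_≡_; _≢_)
open import Relation.Nullary using (¬_)

-- Instructions.  Register indices are natural numbers; the paper only
-- allows indices i ≥ 1, which is imposed by the predicate IsIS below.

data Basic : Set where
  inGet  : ℕ → Basic
  outSet : Bool → Basic
  auxGet : ℕ → Basic
  auxSet : ℕ → Bool → Basic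

data Prim : Set where
  plain : Basic → Prim
  pos   : Basic → Prim
  neg   : Basic → Prim
  jump  : ℕ → Prim
  halt  : Prim

WFBasic : Basic → Set
WFBasic (inGet i)    = 1 ≤ i
WFBasic (outSet b)   = 1 ≤ 1
WFBasic (auxGet i)   = 1 ≤ i
WFBasic (auxSet i b) = 1 ≤ i

WFPrim : Prim → Set
WFPrim (plain a) = WFBasic a
WFPrim (pos a)   = WFBasic a
WFPrim (neg a)   = WFBasic a
WFPrim (jump l)  = 1 ≤ 1
WFPrim halt      = 1 ≤ 1

IsIS : List Prim → Set
IsIS X = All WFPrim X

-- the p-th primitive instruction (1-based positions)
_at_ : List Prim → ℕ → Maybe Prim
[]      at p           = nothing
(u ∷ X) at zero        = nothing
(u ∷ X) at suc zero    = just u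
(u ∷ X) at suc (suc p) = X at suc p

replaceAt : List Prim → ℕ → Prim → List Prim
replaceAt []      p             v = []
replaceAt (u ∷ X) zero          v = u ∷ X
replaceAt (u ∷ X) (suc zero)    v = v ∷ X
replaceAt (u ∷ X) (suc (suc p)) v = u ∷ replaceAt X (suc p) v

record State : Set where
  field
    inp : ℕ → Bool
    out : Bool
    aux : ℕ → Bool
open State public

updFun : (ℕ → Bool) → ℕ → Bool → ℕ → Bool
updFun f i b j = if j ≡ᵇ i then b else f j

reply : Basic → State → Bool
reply (inGet i)    s = inp s i
reply (outSet b)   s = b
reply (auxGet i)   s = aux s i
reply (auxSet i b) s = b

effect : Basic → State → State
effect (inGet i)    s = s
effect (outSet b)   s = record s { out = b }
effect (auxGet i)   s = s
effect (auxSet i b) s = record s { aux = updFun (aux s) i b }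

-- No rule applies when there is no
-- instruction at the current position or for #0, i.e. non-termination.
data Exec (X : List Prim) : ℕ → State → State → Set where
  ex-halt  : ∀ {p s} → X at p ≡ just halt → Exec X p s s
  ex-plain : ∀ {p s s' a} → X at p ≡ just (plain a) →
             Exec X (suc p) (effect a s) s' → Exec X p s s'
  ex-pos-t : ∀ {p s s' a} → X at p ≡ just (pos a) → reply a s ≡ true →
             Exec X (suc p) (effect a s) s' → Exec X p s s'
  ex-pos-f : ∀ {p s s' a} → X at p ≡ just (pos a) → reply a s ≡ false →
             Exec X (suc (suc p)) (effect a s) s' → Exec X p s s'
  ex-neg-f : ∀ {p s s' a} → X at p ≡ just (neg a) → reply a s ≡ false →
             Exec X (suc p) (effect a s) s' → Exec X p s s'
  ex-neg-t : ∀ {p s s' a} → X at p ≡ just (neg a) → reply a s ≡ true →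
             Exec X (suc (suc p)) (effect a s) s' → Exec X p s s'
  ex-jump  : ∀ {p s s' l} → X at p ≡ just (jump l) → 1 ≤ l →
             Exec X (p + l) s s' → Exec X p s s'

Computes : (n : ℕ) → List Prim → ((Fin n → Bool) → Bool) → Set
Computes n X f =
  ∃ λ (k : ℕ) → ∀ (b : Fin n → Bool) (s : State) →
    (∀ (i : Fin n) → inp s (suc (toℕ i)) ≡ b i) →
    out s ≡ false →
    (∀ j → 1 ≤ j → j ≤ k → aux s j ≡ false) →
    ∃ λ (s' : State) → Exec X 1 s s' × out s' ≡ f b

tstnz : (n : ℕ) → (Fin n → Bool) → Bool
tstnz zero    b = false
tstnz (suc n) b = b F.zero ∨ tstnz n (λ i → b (F.suc i))

r : ℕ → Basic
r i = inGet i

seqOver : ℕ → ℕ → (ℕ → List Prim) → List Prim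
seqOver p q P = concatMap P (applyUpTo (p +_) (suc q ∸ p))

BijOn : ℕ → (ℕ → ℕ) → Set
BijOn n ρ =
  (∀ i → 1 ≤ i → i ≤ n → 1 ≤ ρ i × ρ i ≤ n) ×
  (∀ i j → 1 ≤ i → i ≤ n → 1 ≤ j → j ≤ n → ρ i ≡ ρ j → i ≡ j) ×
  (∀ j → 1 ≤ j → j ≤ n → ∃ λ i → 1 ≤ i × i ≤ n × ρ i ≡ j)

OutSetOne : Prim → Set
OutSetOne u = u ≡ plain (outSet true) ⊎ u ≡ pos (outSet true) ⊎ u ≡ neg (outSet true)

LastOK : Prim → Set
LastOK u = u ≡ plain (outSet true) ⊎ u ≡ pos (outSet true)

PhiEvenOK : ℕ → ℕ → Prim → Set
PhiEvenOK h j u =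
  (∃ λ k → 1 ≤ k × k ≤ h ∸ j × u ≡ jump (3 * k)) ⊎ OutSetOne u

CEven : ℕ → List Prim → Set
CEven h X =
  Σ (ℕ → ℕ) λ ρ → Σ (ℕ → Prim) λ φ →
    BijOn (2 * h) ρ ×
    (∀ j → 1 ≤ j → j ≤ h → PhiEvenOK h j (φ j)) ×
    LastOK (φ h) ×
    X ≡ seqOver 1 h (λ i → neg (r (ρ (2 * i ∸ 1))) ∷ pos (r (ρ (2 * i))) ∷ φ i ∷ [])
          ++ (halt ∷ [])

-- odd n = 2h + 1, so (n-1)/2 = h and (n+1)/2 = h + 1
PhiOddOK : ℕ → ℕ → ℕ → Prim → Set
PhiOddOK h m j u =
  (∃ λ k → 1 ≤ k × k ≤ suc h ∸ j × (j ≤ m × m < j + k) × u ≡ jump (3 * k ∸ 1)) ⊎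
  (∃ λ k → 1 ≤ k × k ≤ suc h ∸ j × ¬ (j ≤ m × m < j + k) × u ≡ jump (3 * k)) ⊎
  OutSetOne u

COdd : ℕ → List Prim → Set
COdd h X =
  Σ ℕ λ m → Σ (ℕ → ℕ) λ ρ → Σ (ℕ → Prim) λ φ →
    m ≤ h ×
    BijOn (suc (2 * h)) ρ ×
    (∀ j → 1 ≤ j → j ≤ suc h → PhiOddOK h m j (φ j)) ×
    LastOK (φ (suc h)) ×
    X ≡ seqOver 1 m (λ i → neg (r (ρ (2 * i ∸ 1))) ∷ pos (r (ρ (2 * i))) ∷ φ i ∷ [])
          ++ (pos (r (ρ (suc (2 * m)))) ∷ φ (suc m) ∷ [])
          ++ seqOver (suc m) h
               (λ i → neg (r (ρ (2 * i))) ∷ pos (r (ρ (suc (2 * i)))) ∷ φ (suc i) ∷ [])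
          ++ (halt ∷ [])

InC : ℕ → List Prim → Set
InC n X =
  (∃ λ h → n ≡ 2 * h × CEven h X) ⊎
  (∃ λ h → n ≡ suc (2 * h) × COdd h X)

readsReg : ℕ → Prim → Bool
readsReg i (pos (inGet j)) = j ≡ᵇ i
readsReg i (neg (inGet j)) = j ≡ᵇ i
readsReg i _               = false

readCount : ℕ → List Prim → ℕ
readCount i []      = 0
readCount i (u ∷ X) = (if readsReg i u then 1 else 0) + readCount i X

ReadsAt : List Prim → ℕ → ℕ → Set
ReadsAt X p i = X at p ≡ just (pos (inGet i)) ⊎ X at p ≡ just (neg (inGet i))

data Chain (X : List Prim) : ℕ → ℕ → Set where
  chain-refl : ∀ {p} → Chain X p p
  chain-step : ∀ {p q l} → X at p ≡ just (jump l) → 1 ≤ l →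
               Chain X (p + l) q → Chain X p q

InE : ℕ → List Prim → Set
InE n X =
  ((∀ i → readCount i X ≤ 1) × InC n X) ⊎
  (∃ λ i → readCount i X ≡ 2 × (∀ j → j ≢ i → readCount j X ≤ 1) ×
     ∃ λ k → ∃ λ l → k ≢ l × ReadsAt X k i × ReadsAt X l i ×
       (∀ p → p ≤ k + 2 → ¬ Chain X p l) ×
       (∃ λ i' → i' ≤ n × X at l ≡ just (pos (inGet i'))) ×
       InC n (replaceAt X l (jump 2)))

-- A program in C_n is a row of blocks -r_a;+r_b;φ(j) (plus one block +r_a;φ(m+1) when n is
-- odd) reading every input register once. A block whose registers are both 0 falls through to
-- the next one; otherwise control reaches φ(j), which sets out to 1 or jumps forward to a later
-- φ, and the last φ sets out. As nothing resets out, the program halts with out = 1 exactly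
-- when some block fires, i.e. some input is 1; this is shown block by block, by downward
-- induction, relative to invariants on out at the two entry points of a block.
--
-- If in:i is read a second time, by +in:i.get at l, then replacing it by #2 gives a program
-- in C_n. When in:i = 0 the read acts as #2. When in:i = 1, the block containing the first
-- read (at k) fires, its φ lies at most at k + 2, and by (a) no chain of jumps leads from
-- there to l; so l is reached only after out has been set, and the read does no harm.

module Submission where

open import Defs
open import Data.Bool using (Bool; true; false)
open import Data.Fin using (Fin; toℕ; fromℕ<)
import Data.Fin as Fin
open import Data.Fin.Properties using (toℕ<n; toℕ-fromℕ<)
open import Data.List using (List; []; _∷_; _++_; concatMap; applyUpTo)
open import Data.Maybe using (just)
open import Data.Maybe.Properties using (just-injective)
open import Data.Nat using (ℕ; zero; suc; _+_; _*_; _∸_; _≤_; _<_; z≤n; s≤s; _≤?_; _≟_)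
open import Data.Nat.Properties
open import Data.Nat.Tactic.RingSolver using (solve-∀)
open import Data.Product using (∃; _×_; _,_; proj₁; proj₂)
open import Data.Sum using (_⊎_; inj₁; inj₂; [_,_])
open import Data.Sum.Function.Propositional using (_⊎-⇔_)
open import Data.Unit using (⊤; tt)
open import Function using (_∘_; id)
open import Function.Bundles using (_⇔_; mk⇔; Equivalence)
open import Function.Construct.Composition using (_⇔-∘_)
open import Function.Construct.Identity using (⇔-id)
open import Function.Construct.Symmetry using (⇔-sym)
open import Relation.Binary.PropositionalEquality using (_≡_; _≢_; refl; sym; trans; cong; subst; module ≡-Reasoning)
open import Relation.Binary.Definitions using (tri<; tri≈; tri>)
open import Relation.Nullary using (¬_; yes; no; contradiction)

downward-induction : (P : ℕ → Set) (top : ℕ) →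
                     (∀ j → j ≤ top → (∀ j' → j < j' → j' ≤ top → P j') → P j) →
                     ∀ j → j ≤ top → P j
downward-induction P top step j j≤top = go top j j≤top (m≤m+n top j)
  where
  go : ∀ d j → j ≤ top → top ≤ d + j → P j
  go zero    j j≤top top≤j = step j j≤top λ j' j<j' j'≤top →
    contradiction (≤-trans j'≤top top≤j) (<⇒≱ j<j')
  go (suc d) j j≤top top≤  = step j j≤top λ j' j<j' j'≤top →
    go d j' j'≤top (≤-trans top≤ (≤-trans (≤-reflexive (sym (+-suc d j))) (+-monoʳ-≤ d j<j')))

≡true⇔≡true⇒≡ : ∀ {a b : Bool} → a ≡ true ⇔ b ≡ true → a ≡ b
≡true⇔≡true⇒≡ {false} {false} _   = refl
≡true⇔≡true⇒≡ {false} {true}  a⇔b = Equivalence.from a⇔b refl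
≡true⇔≡true⇒≡ {true}  {_}     a⇔b = sym (Equivalence.to a⇔b refl)

tstnz≡true⇔ : ∀ n (b : Fin n → Bool) → tstnz n b ≡ true ⇔ ∃ λ i → b i ≡ true
tstnz≡true⇔ n b = mk⇔ (to n b) (λ (i , bi) → from n b i bi)
  where
  to : ∀ n (b : Fin n → Bool) → tstnz n b ≡ true → ∃ λ i → b i ≡ true
  to (suc n) b t with b Fin.zero in b₀
  ... | true  = Fin.zero , b₀
  ... | false = let i , bi = to n (b ∘ Fin.suc) t in Fin.suc i , bi
  from : ∀ n (b : Fin n → Bool) i → b i ≡ true → tstnz n b ≡ true
  from (suc n) b Fin.zero    bi rewrite bi = refl
  from (suc n) b (Fin.suc i) bi with b Fin.zero
  ... | true  = refl
  ... | false = from n (b ∘ Fin.suc) i bi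

some-input⇔ : ∀ {n} (I : ℕ → Bool) (b : Fin n → Bool) → (∀ i → I (suc (toℕ i)) ≡ b i) →
              (∃ λ x → 1 ≤ x × x ≤ n × I x ≡ true) ⇔ ∃ λ i → b i ≡ true
some-input⇔ {n} I b I≡b = mk⇔ to from
  where
  to : (∃ λ x → 1 ≤ x × x ≤ n × I x ≡ true) → ∃ λ i → b i ≡ true
  to (suc x , _ , x<n , t) =
    fromℕ< x<n , trans (sym (I≡b _)) (subst (λ y → I (suc y) ≡ true) (sym (toℕ-fromℕ< x<n)) t)
  from : (∃ λ i → b i ≡ true) → ∃ λ x → 1 ≤ x × x ≤ n × I x ≡ true
  from (i , t) = suc (toℕ i) , s≤s z≤n , toℕ<n i , trans (I≡b i) t


-- Block-structured programs and their execution

exec-≡ : ∀ {X p q s s'} → p ≡ q → Exec X p s s' → Exec X q s s'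
exec-≡ refl e = e

_◃_ : ∀ {X p q s₀ s} {Q : State → Set} →
      (∀ {s'} → Exec X q s₀ s' → Exec X p s s') →
      (∃ λ s' → Exec X q s₀ s' × Q s') → ∃ λ s' → Exec X p s s' × Q s'
f ◃ (s' , e , q) = s' , f e , q
infixr 4 _◃_

-- pφ j is the position of φ(j), the last instruction of block j.
start : (ℕ → ℕ) → ℕ → ℕ
start pφ j = suc (pφ (j ∸ 1))

data Block (X : List Prim) (pφ ra rb : ℕ → ℕ) (j : ℕ) : Set where
  double : X at start pφ j ≡ just (neg (r (ra j))) → X at suc (start pφ j) ≡ just (pos (r (rb j))) →
           pφ j ≡ 2 + start pφ j → Block X pφ ra rb j
  single : X at start pφ j ≡ just (pos (r (ra j))) → rb j ≡ ra j →
           pφ j ≡ suc (start pφ j) → Block X pφ ra rb j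

record Skeleton (X : List Prim) : Set where
  field
    blocks   : ℕ
    pφ ra rb : ℕ → ℕ
    pφ-zero  : pφ 0 ≡ 0
    block    : ∀ {j} → 1 ≤ j → j ≤ blocks → Block X pφ ra rb j
    halts    : X at start pφ (suc blocks) ≡ just halt

  pφ-step : ∀ {j} → suc j ≤ blocks → 2 + pφ j ≤ pφ (suc j)
  pφ-step sj≤ with block (s≤s z≤n) sj≤
  ... | double _ _ eq = ≤-trans (n≤1+n _) (≤-reflexive (sym eq))
  ... | single _ _ eq = ≤-reflexive (sym eq)

  pφ≤2+start : ∀ {j} → 1 ≤ j → j ≤ blocks → pφ j ≤ 2 + start pφ j
  pφ≤2+start 1≤j j≤ with block 1≤j j≤
  ... | double _ _ eq = ≤-reflexive eq
  ... | single _ _ eq = ≤-trans (≤-reflexive eq) (n≤1+n _)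

  pφ-mono : ∀ {j j'} → j ≤ j' → j' ≤ blocks → pφ j ≤ pφ j'
  pφ-mono {j' = zero}   z≤n _ = ≤-refl
  pφ-mono {j' = suc j'} j≤ sj'≤ with m≤n⇒m<n∨m≡n j≤
  ... | inj₂ refl        = ≤-refl
  ... | inj₁ (s≤s j≤j') =
    ≤-trans (pφ-mono j≤j' (<⇒≤ sj'≤)) (≤-trans (m≤n+m _ 2) (pφ-step sj'≤))

  pφ-tight : ∀ {j j'} → j < j' → j' ≤ blocks → pφ j + 2 ≡ pφ j' → pφ (suc j) ≡ 2 + pφ j
  pφ-tight {j} j<j' j'≤ eq = ≤-antisym
    (≤-trans (pφ-mono j<j' j'≤) (≤-reflexive (trans (sym eq) (+-comm (pφ j) 2))))
    (pφ-step (≤-trans j<j' j'≤))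

module _ {X : List Prim} (S : Skeleton X) where
  open Skeleton S

  data Tail (j : ℕ) : Set where
    sets-plain : X at pφ j ≡ just (plain (outSet true)) → Tail j
    sets-pos   : X at pφ j ≡ just (pos (outSet true)) → Tail j
    sets-neg   : X at pφ j ≡ just (neg (outSet true)) → j < blocks → Tail j
    jumps      : ∀ {L j'} → X at pφ j ≡ just (jump L) → 1 ≤ L → pφ j + L ≡ pφ j' →
                 j < j' → j' ≤ blocks → Tail j

  record Covering (n : ℕ) : Set where
    field
      ra-range : ∀ {j} → 1 ≤ j → j ≤ blocks → 1 ≤ ra j × ra j ≤ n
      rb-range : ∀ {j} → 1 ≤ j → j ≤ blocks → 1 ≤ rb j × rb j ≤ n
      covers   : ∀ {x} → 1 ≤ x → x ≤ n → ∃ λ j → 1 ≤ j × j ≤ blocks × (ra j ≡ x ⊎ rb j ≡ x)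

  module Firing (I : ℕ → Bool) where

    Fires : ℕ → Set
    Fires j = I (ra j) ≡ true ⊎ I (rb j) ≡ true

    FiresFrom : ℕ → Set
    FiresFrom j = ∃ λ j' → j ≤ j' × j' ≤ blocks × Fires j'

    firesFrom-pass : ∀ {j} → I (ra j) ≡ false → I (rb j) ≡ false → FiresFrom (suc j) ⇔ FiresFrom j
    firesFrom-pass {j} a₀ b₀ = mk⇔ (λ (j' , j<j' , j'≤ , f) → j' , <⇒≤ j<j' , j'≤ , f) later
      where
      later : FiresFrom j → FiresFrom (suc j)
      later (j' , j≤j' , j'≤ , f) with m≤n⇒m<n∨m≡n j≤j' | f
      ... | inj₁ j<j' | _      = j' , j<j' , j'≤ , f
      ... | inj₂ refl | inj₁ t with () ← trans (sym t) a₀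
      ... | inj₂ refl | inj₂ t with () ← trans (sym t) b₀

    covering-firesFrom⇔ : ∀ {n} → Covering n → FiresFrom 1 ⇔ ∃ λ x → 1 ≤ x × x ≤ n × I x ≡ true
    covering-firesFrom⇔ {n} C = mk⇔ to from
      where
      open Covering C
      to : FiresFrom 1 → ∃ λ x → 1 ≤ x × x ≤ n × I x ≡ true
      to (j , 1≤j , j≤ , inj₁ t) = let 1≤a , a≤n = ra-range 1≤j j≤ in ra j , 1≤a , a≤n , t
      to (j , 1≤j , j≤ , inj₂ t) = let 1≤b , b≤n = rb-range 1≤j j≤ in rb j , 1≤b , b≤n , t
      from : (∃ λ x → 1 ≤ x × x ≤ n × I x ≡ true) → FiresFrom 1
      from (x , 1≤x , x≤n , t) with covers 1≤x x≤n
      ... | j , 1≤j , j≤ , inj₁ refl = j , 1≤j , j≤ , inj₁ t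
      ... | j , 1≤j , j≤ , inj₂ refl = j , 1≤j , j≤ , inj₂ t

-- Pφ j b and Pstart j b are invariants on the content b of out whenever control reaches φ(j),
-- resp. the start of block j, on input I.
module Execution {X : List Prim} (S : Skeleton X) (I : ℕ → Bool) (Pφ Pstart : ℕ → Bool → Set) where
  open Skeleton S
  open Firing S I

  HasInputs : State → Set
  HasInputs s = ∀ x → inp s x ≡ I x

  -- guarded is a second read +in:i.get standing where the program in C_n has #2.
  data Exit (j : ℕ) : Set where
    tail    : Tail S j → Exit j
    guarded : ∀ {i} → X at pφ j ≡ just (pos (inGet i)) → j < blocks → pφ (suc j) ≡ 2 + pφ j →
              (I i ≡ true → ∀ {b} → Pφ j b → b ≡ true) →
              (I i ≡ false → ∀ {b} → Pφ j b → Pφ (suc j) b) → Exit j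

  ExitSets : ℕ → Set
  ExitSets j = ∀ s → HasInputs s → Pφ j (out s) → ∃ λ s' → Exec X (pφ j) s s' × out s' ≡ true

  Decides : ℕ → State → State → Set
  Decides j s s' = out s' ≡ true ⇔ (out s ≡ true ⊎ FiresFrom j)

  RunsFrom : ℕ → Set
  RunsFrom j = ∀ s → HasInputs s → Pstart j (out s) → ∃ λ s' → Exec X (start pφ j) s s' × Decides j s s'

  runsFrom-one : RunsFrom 1 → ∀ s → HasInputs s → out s ≡ false → Pstart 1 false →
                 ∃ λ s' → Exec X 1 s s' × (out s' ≡ true ⇔ FiresFrom 1)
  runsFrom-one runs s ok o p with runs s ok (subst (Pstart 1) (sym o) p)
  ... | s' , ex , dec = s' , exec-≡ (cong suc pφ-zero) ex , out-false ⇔-∘ dec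
    where
    out-false : (out s ≡ true ⊎ FiresFrom 1) ⇔ FiresFrom 1
    out-false = mk⇔ (λ { (inj₁ t) → contradiction (trans (sym o) t) λ () ; (inj₂ f) → f }) inj₂

  module Run
    (exit           : ∀ {j} → 1 ≤ j → j ≤ blocks → Exit j)
    (jump-preserves : ∀ {j L j' b} → X at pφ j ≡ just (jump L) → 1 ≤ L → pφ j + L ≡ pφ j' →
                      Pφ j b → Pφ j' b)
    (Pφ-true        : ∀ j → Pφ j true)
    (Pstart-true    : ∀ j → Pstart j true)
    (enter          : ∀ {j b} → 1 ≤ j → j ≤ blocks → Fires j → Pstart j b → Pφ j b)
    (pass           : ∀ {j b} → 1 ≤ j → j ≤ blocks → I (ra j) ≡ false → I (rb j) ≡ false →
                      Pstart j b → Pstart (suc j) b)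
    where

    Runs : ℕ → Set
    Runs j = (j ≤ blocks → ExitSets j) × RunsFrom j

    Later : ℕ → Set
    Later j = ∀ j' → j < j' → j' ≤ suc blocks → 1 ≤ j' → Runs j'

    stays-set-from : ∀ {j j'} → Later j → j < j' → j' ≤ suc blocks →
                    ∀ s → HasInputs s → out s ≡ true → ∃ λ s' → Exec X (start pφ j') s s' × out s' ≡ true
    stays-set-from later j<j' j'≤ s ok o
      with proj₂ (later _ j<j' j'≤ (≤-trans (s≤s z≤n) j<j')) s ok (subst (Pstart _) (sym o) (Pstart-true _))
    ... | s' , ex , dec = s' , ex , Equivalence.from dec (inj₁ o)

    exit-later : ∀ {j j'} → Later j → j < j' → j' ≤ blocks → ExitSets j'
    exit-later later j<j' j'≤ = proj₁ (later _ j<j' (m≤n⇒m≤1+n j'≤) (≤-trans (s≤s z≤n) j<j')) j'≤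

    stays-set-after-skip : ∀ {j} → Later j → j < blocks →
                          ∀ s → HasInputs s → out s ≡ true → ∃ λ s' → Exec X (2 + pφ j) s s' × out s' ≡ true
    stays-set-after-skip {j} later j<b s ok o with block (s≤s z≤n) j<b
    ... | single _ _ eq = exec-≡ eq ◃ exit-later later ≤-refl j<b s ok (subst (Pφ _) (sym o) (Pφ-true _))
    ... | double _ x eq with I (rb (suc j)) in e
    ...   | true  = ex-pos-t x (trans (ok _) e) ∘ exec-≡ eq ◃
                    exit-later later ≤-refl j<b s ok (subst (Pφ _) (sym o) (Pφ-true _))
    ...   | false = ex-pos-f x (trans (ok _) e) ∘ exec-≡ (cong suc eq) ◃
                    stays-set-from later (m≤n⇒m≤1+n ≤-refl) (s≤s j<b) s ok o

    exit-sets : ∀ {j} → 1 ≤ j → j ≤ blocks → Later j → ExitSets j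
    exit-sets 1≤j j≤ later s ok p with exit 1≤j j≤
    ... | tail (sets-plain x) = ex-plain x ◃ stays-set-from later ≤-refl (s≤s j≤) _ ok refl
    ... | tail (sets-pos x)   = ex-pos-t x refl ◃ stays-set-from later ≤-refl (s≤s j≤) _ ok refl
    ... | tail (sets-neg x j<b) = ex-neg-t x refl ◃ stays-set-after-skip later j<b _ ok refl
    ... | tail (jumps x 1≤L eq j<j' j'≤) =
      ex-jump x 1≤L ∘ exec-≡ (sym eq) ◃ exit-later later j<j' j'≤ s ok (jump-preserves x 1≤L eq p)
    ... | guarded {i} x j<b eq on-true on-false with I i in e
    ...   | true  = ex-pos-t x (trans (ok i) e) ◃
                    stays-set-from later ≤-refl (s≤s j≤) s ok (on-true refl p)
    ...   | false = ex-pos-f x (trans (ok i) e) ∘ exec-≡ eq ◃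
                    exit-later later ≤-refl j<b s ok (on-false refl p)

    runs-fired : ∀ {j} → 1 ≤ j → j ≤ blocks → ExitSets j → Fires j →
                 ∀ s → HasInputs s → Pstart j (out s) → ∃ λ s' → Exec X (pφ j) s s' × Decides j s s'
    runs-fired 1≤j j≤ exits f s ok p with exits s ok (enter 1≤j j≤ f p)
    ... | s' , ex , o = s' , ex , mk⇔ (λ _ → inj₂ (_ , ≤-refl , j≤ , f)) (λ _ → o)

    runs-passed : ∀ {j} → 1 ≤ j → j ≤ blocks → Later j → I (ra j) ≡ false → I (rb j) ≡ false →
                  ∀ s → HasInputs s → Pstart j (out s) → ∃ λ s' → Exec X (start pφ (suc j)) s s' × Decides j s s'
    runs-passed 1≤j j≤ later a₀ b₀ s ok p
      with proj₂ (later _ ≤-refl (s≤s j≤) (s≤s z≤n)) s ok (pass 1≤j j≤ a₀ b₀ p)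
    ... | s' , ex , dec = s' , ex , (⇔-id _ ⊎-⇔ firesFrom-pass a₀ b₀) ⇔-∘ dec

    runs-from : ∀ {j} → 1 ≤ j → j ≤ blocks → Later j → ExitSets j → RunsFrom j
    runs-from {j} 1≤j j≤ later exits s ok p with block 1≤j j≤ | I (ra j) in a
    ... | double x _ eq | true  = ex-neg-t x (trans (ok _) a) ∘ exec-≡ eq ◃
                                  runs-fired 1≤j j≤ exits (inj₁ a) s ok p
    ... | single x _ eq | true  = ex-pos-t x (trans (ok _) a) ∘ exec-≡ eq ◃
                                  runs-fired 1≤j j≤ exits (inj₁ a) s ok p
    ... | single x rb≡ra eq | false = ex-pos-f x (trans (ok _) a) ∘ exec-≡ (cong suc eq) ◃
                                      runs-passed 1≤j j≤ later a (trans (cong I rb≡ra) a) s ok p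
    ... | double x y eq | false with I (rb j) in b
    ...   | true  = ex-neg-f x (trans (ok _) a) ∘ ex-pos-t y (trans (ok _) b) ∘ exec-≡ eq ◃
                    runs-fired 1≤j j≤ exits (inj₂ b) s ok p
    ...   | false = ex-neg-f x (trans (ok _) a) ∘ ex-pos-f y (trans (ok _) b) ∘ exec-≡ (cong suc eq) ◃
                    runs-passed 1≤j j≤ later a b s ok p

    runs-from-end : RunsFrom (suc blocks)
    runs-from-end s _ _ = s , ex-halt halts ,
      mk⇔ inj₁ λ { (inj₁ o) → o ; (inj₂ (_ , b<j , j≤b , _)) → contradiction j≤b (<⇒≱ b<j) }

    runs-from-one : RunsFrom 1
    runs-from-one = proj₂ (downward-induction (λ j → 1 ≤ j → Runs j) (suc blocks) runs 1 (s≤s z≤n) ≤-refl)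
      where
      runs : ∀ j → j ≤ suc blocks → Later j → 1 ≤ j → Runs j
      runs j j≤ later 1≤j with m≤n⇒m<n∨m≡n j≤
      ... | inj₂ refl      = (λ b<b → contradiction b<b (n≮n blocks)) , runs-from-end
      ... | inj₁ (s≤s j≤b) = (λ _ → exits) , runs-from 1≤j j≤b later exits
        where
        exits : ExitSets j
        exits = exit-sets 1≤j j≤b later

DetectsFiring : ∀ {X} → Skeleton X → Set
DetectsFiring {X} S = ∀ s → out s ≡ false →
  ∃ λ s' → Exec X 1 s s' × (out s' ≡ true ⇔ Firing.FiresFrom S (inp s) 1)

detects⇒computes : ∀ {n X} (S : Skeleton X) → Covering S n → DetectsFiring S → Computes n X (tstnz n)
detects⇒computes {n} S C detects = 0 , λ b s inputs o _ →
  let s' , ex , dec = detects s o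
      open Firing S (inp s)
  in s' , ex , ≡true⇔≡true⇒≡
       (⇔-sym (tstnz≡true⇔ n b) ⇔-∘ (some-input⇔ (inp s) b inputs ⇔-∘ (covering-firesFrom⇔ C ⇔-∘ dec)))

record Layout (n : ℕ) (X : List Prim) : Set where
  field
    skeleton : Skeleton X
    tails    : ∀ {j} → 1 ≤ j → j ≤ Skeleton.blocks skeleton → Tail skeleton j
    covering : Covering skeleton n

layout-detects : ∀ {n X} (L : Layout n X) → DetectsFiring (Layout.skeleton L)
layout-detects L s o = runsFrom-one R.runs-from-one s (λ _ → refl) o tt
  where
  open Layout L
  open Execution skeleton (inp s) (λ _ _ → ⊤) (λ _ _ → ⊤)
  module R = Run (λ 1≤j j≤ → tail (tails 1≤j j≤)) (λ _ _ _ _ → tt) (λ _ → tt) (λ _ → tt)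
                 (λ _ _ _ _ → tt) (λ _ _ _ _ _ → tt)

-- Layouts of the programs in C_n

module Triples (a b c : ℕ → Prim) where
  triple : ℕ → List Prim
  triple i = a i ∷ b i ∷ c i ∷ []

  triples : (ℕ → ℕ) → ℕ → List Prim → List Prim
  triples f t R = concatMap triple (applyUpTo f t) ++ R

  at-fst : ∀ f t R {u} → u < t → triples f t R at suc (3 * u) ≡ just (a (f u))
  at-fst f (suc t) R {zero}  _         = refl
  at-fst f (suc t) R {suc u} (s≤s u<t) rewrite *-suc 3 u = at-fst (f ∘ suc) t R u<t

  at-snd : ∀ f t R {u} → u < t → triples f t R at suc (suc (3 * u)) ≡ just (b (f u))
  at-snd f (suc t) R {zero}  _         = refl
  at-snd f (suc t) R {suc u} (s≤s u<t) rewrite *-suc 3 u = at-snd (f ∘ suc) t R u<t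

  at-thd : ∀ f t R {u} → u < t → triples f t R at suc (suc (suc (3 * u))) ≡ just (c (f u))
  at-thd f (suc t) R {zero}  _         = refl
  at-thd f (suc t) R {suc u} (s≤s u<t) rewrite *-suc 3 u = at-thd (f ∘ suc) t R u<t

  private
    3*suc+ : ∀ t p → 3 * suc t + p ≡ suc (suc (suc (3 * t + p)))
    3*suc+ = solve-∀

  at-rest : ∀ f t R p → triples f t R at suc (3 * t + p) ≡ R at suc p
  at-rest f zero    R p = refl
  at-rest f (suc t) R p rewrite 3*suc+ t p = at-rest (f ∘ suc) t R p

module _ {X : List Prim} (S : Skeleton X) {N : ℕ} {ρ : ℕ → ℕ} (bij : BijOn N ρ) where
  open Skeleton S

  covering-by-indices : (ia ib : ℕ → ℕ) → (∀ j → ra j ≡ ρ (ia j)) → (∀ j → rb j ≡ ρ (ib j)) →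
    (∀ {j} → 1 ≤ j → j ≤ blocks → (1 ≤ ia j × ia j ≤ N) × (1 ≤ ib j × ib j ≤ N)) →
    (∀ {i} → 1 ≤ i → i ≤ N → ∃ λ j → 1 ≤ j × j ≤ blocks × (ia j ≡ i ⊎ ib j ≡ i)) →
    Covering S N
  covering-by-indices ia ib ra≡ rb≡ ranges covers-indices = record
    { ra-range = λ 1≤j j≤ → let (1≤a , a≤N) , _ = ranges 1≤j j≤ in
                            subst (λ x → 1 ≤ x × x ≤ N) (sym (ra≡ _)) (ρ-range 1≤a a≤N)
    ; rb-range = λ 1≤j j≤ → let _ , (1≤b , b≤N) = ranges 1≤j j≤ in
                            subst (λ x → 1 ≤ x × x ≤ N) (sym (rb≡ _)) (ρ-range 1≤b b≤N)
    ; covers   = covers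
    }
    where
    ρ-range : ∀ {i} → 1 ≤ i → i ≤ N → 1 ≤ ρ i × ρ i ≤ N
    ρ-range = proj₁ bij _
    covers : ∀ {x} → 1 ≤ x → x ≤ N → ∃ λ j → 1 ≤ j × j ≤ blocks × (ra j ≡ x ⊎ rb j ≡ x)
    covers 1≤x x≤N with proj₂ (proj₂ bij) _ 1≤x x≤N
    ... | i , 1≤i , i≤N , ρi≡x with covers-indices 1≤i i≤N
    ...   | j , 1≤j , j≤ , inj₁ refl = j , 1≤j , j≤ , inj₁ (trans (ra≡ j) ρi≡x)
    ...   | j , 1≤j , j≤ , inj₂ refl = j , 1≤j , j≤ , inj₂ (trans (rb≡ j) ρi≡x)

even⊎odd : ∀ i → ∃ λ q → i ≡ 2 * q ⊎ i ≡ suc (2 * q)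
even⊎odd zero = 0 , inj₁ refl
even⊎odd (suc i) with even⊎odd i
... | q , inj₁ refl = q , inj₂ refl
... | q , inj₂ refl = suc q , inj₁ (sym (*-suc 2 q))

2*suc∸1 : ∀ t → 2 * suc t ∸ 1 ≡ suc (2 * t)
2*suc∸1 t = cong (_∸ 1) (*-suc 2 t)

+-≤-∸ : ∀ {j k h} → j ≤ h → k ≤ h ∸ j → j + k ≤ h
+-≤-∸ {j} {k} {h} j≤h k≤ = subst (_≤ h) (+-comm k j) (m≤o∸n⇒m+n≤o k j≤h k≤)

below-last : ∀ {φ : ℕ → Prim} {j h} → j ≤ h → LastOK (φ h) → φ j ≡ neg (outSet true) → j < h
below-last j≤h last φj with m≤n⇒m<n∨m≡n j≤h | last
... | inj₁ j<h  | _         = j<h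
... | inj₂ refl | inj₁ φh with () ← trans (sym φj) φh
... | inj₂ refl | inj₂ φh with () ← trans (sym φj) φh

module EvenLayout (h : ℕ) (ρ : ℕ → ℕ) (φ : ℕ → Prim) where
  open Triples (λ i → neg (r (ρ (2 * i ∸ 1)))) (λ i → pos (r (ρ (2 * i)))) φ

  Y : List Prim
  Y = triples suc h (halt ∷ [])

  block : ∀ {j} → 1 ≤ j → j ≤ h → Block Y (3 *_) (λ j → ρ (2 * j ∸ 1)) (λ j → ρ (2 * j)) j
  block {suc t} _ t<h = double (at-fst suc h _ t<h) (at-snd suc h _ t<h) (*-suc 3 t)

  skeleton : Skeleton Y
  skeleton = record
    { blocks = h ; pφ = 3 *_ ; ra = λ j → ρ (2 * j ∸ 1) ; rb = λ j → ρ (2 * j)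
    ; pφ-zero = refl ; block = block
    ; halts = subst (λ p → Y at suc p ≡ just halt) (+-identityʳ (3 * h)) (at-rest suc h _ 0)
    }

  φ-at : ∀ {j u} → 1 ≤ j → j ≤ h → φ j ≡ u → Y at (3 * j) ≡ just u
  φ-at {suc t} _ t<h refl = subst (λ p → Y at p ≡ just (φ (suc t))) (sym (*-suc 3 t)) (at-thd suc h _ t<h)

  tail : LastOK (φ h) → ∀ {j} → 1 ≤ j → j ≤ h → PhiEvenOK h j (φ j) → Tail skeleton j
  tail last {j} 1≤j j≤h (inj₁ (k , 1≤k , k≤ , φj)) =
    jumps (φ-at 1≤j j≤h φj) (≤-trans 1≤k (m≤m+n k _)) (sym (*-distribˡ-+ 3 j k)) (m<m+n j 1≤k)
          (+-≤-∸ j≤h k≤)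
  tail last 1≤j j≤h (inj₂ (inj₁ φj))         = sets-plain (φ-at 1≤j j≤h φj)
  tail last 1≤j j≤h (inj₂ (inj₂ (inj₁ φj)))  = sets-pos (φ-at 1≤j j≤h φj)
  tail last 1≤j j≤h (inj₂ (inj₂ (inj₂ φj)))  = sets-neg (φ-at 1≤j j≤h φj) (below-last {φ} j≤h last φj)

  index-ranges : ∀ {j} → 1 ≤ j → j ≤ h → (1 ≤ 2 * j ∸ 1 × 2 * j ∸ 1 ≤ 2 * h) × (1 ≤ 2 * j × 2 * j ≤ 2 * h)
  index-ranges {suc t} _ t<h =
    (subst (1 ≤_) (sym (2*suc∸1 t)) (s≤s z≤n) , ≤-trans (m∸n≤m _ 1) (*-monoʳ-≤ 2 t<h)) ,
    (s≤s z≤n , *-monoʳ-≤ 2 t<h)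

  covers-indices : ∀ {i} → 1 ≤ i → i ≤ 2 * h → ∃ λ j → 1 ≤ j × j ≤ h × (2 * j ∸ 1 ≡ i ⊎ 2 * j ≡ i)
  covers-indices {i} 1≤i i≤ with even⊎odd i
  ... | zero  , inj₁ refl = contradiction 1≤i λ ()
  ... | suc q , inj₁ refl = suc q , s≤s z≤n , *-cancelˡ-≤ 2 i≤ , inj₂ refl
  ... | q     , inj₂ refl = suc q , s≤s z≤n , *-cancelˡ-< 2 q h i≤ , inj₁ (2*suc∸1 q)

  layout : BijOn (2 * h) ρ → (∀ j → 1 ≤ j → j ≤ h → PhiEvenOK h j (φ j)) → LastOK (φ h) → Layout (2 * h) Y
  layout bij φ-ok last = record
    { skeleton = skeleton
    ; tails    = λ 1≤j j≤h → tail last 1≤j j≤h (φ-ok _ 1≤j j≤h)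
    ; covering = covering-by-indices skeleton bij _ _ (λ _ → refl) (λ _ → refl) index-ranges covers-indices
    }

piecewise : ℕ → (ℕ → ℕ) → (ℕ → ℕ) → ℕ → ℕ
piecewise c f g j with j ≤? c
... | yes _ = f j
... | no  _ = g j

piecewise-≤ : ∀ {c f g j} → j ≤ c → piecewise c f g j ≡ f j
piecewise-≤ {c} {j = j} j≤c with j ≤? c
... | yes _   = refl
... | no  j≰c = contradiction j≤c j≰c

piecewise-> : ∀ {c f g j} → c < j → piecewise c f g j ≡ g j
piecewise-> {c} {j = j} c<j with j ≤? c
... | yes j≤c = contradiction j≤c (<⇒≱ c<j)
... | no  _   = refl

data Region (m : ℕ) : ℕ → Set where
  before : ∀ {t} → t < m → Region m (suc t)
  middle : Region m (suc m)
  after  : ∀ u → Region m (suc (suc m + u))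

region : ∀ m {j} → 1 ≤ j → Region m j
region m {suc t} _ with <-cmp t m
... | tri< t<m _ _ = before t<m
... | tri≈ _ refl _ = middle
... | tri> _ _ m<t with u , refl ← m≤n⇒∃[o]m+o≡n m<t = after u

3*suc∸1 : ∀ t → 3 * suc t ∸ 1 ≡ suc (suc (3 * t))
3*suc∸1 t = cong (_∸ 1) (*-suc 3 t)

2*suc∸2 : ∀ t → 2 * suc t ∸ 2 ≡ 2 * t
2*suc∸2 t = cong (_∸ 2) (*-suc 2 t)

module OddLayout (h m : ℕ) (ρ : ℕ → ℕ) (φ : ℕ → Prim) (m≤h : m ≤ h) where
  module Before = Triples (λ i → neg (r (ρ (2 * i ∸ 1)))) (λ i → pos (r (ρ (2 * i)))) φ
  module After  = Triples (λ i → neg (r (ρ (2 * i)))) (λ i → pos (r (ρ (suc (2 * i))))) (φ ∘ suc)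

  Y : List Prim
  Y = Before.triples suc m
        (pos (r (ρ (suc (2 * m)))) ∷ φ (suc m) ∷ After.triples (suc m +_) (h ∸ m) (halt ∷ []))

  -- The single block +r;φ(m+1) shifts all later positions back by one.
  pφ ia ib : ℕ → ℕ
  pφ = piecewise m (3 *_) (λ j → 3 * j ∸ 1)
  ia = piecewise (suc m) (λ j → 2 * j ∸ 1) (λ j → 2 * j ∸ 2)
  ib = piecewise m (2 *_) (λ j → 2 * j ∸ 1)

  pφ-≤ : ∀ {j} → j ≤ m → pφ j ≡ 3 * j
  pφ-≤ = piecewise-≤
  pφ-> : ∀ {j} → m < j → pφ j ≡ 3 * j ∸ 1
  pφ-> = piecewise->
  ia-≤ : ∀ {j} → j ≤ suc m → ia j ≡ 2 * j ∸ 1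
  ia-≤ = piecewise-≤
  ia-> : ∀ {j} → suc m < j → ia j ≡ 2 * j ∸ 2
  ia-> = piecewise->
  ib-≤ : ∀ {j} → j ≤ m → ib j ≡ 2 * j
  ib-≤ = piecewise-≤
  ib-> : ∀ {j} → m < j → ib j ≡ 2 * j ∸ 1
  ib-> = piecewise->

  at-cong : ∀ {p q u v} → p ≡ q → u ≡ v → Y at q ≡ just v → Y at p ≡ just u
  at-cong refl refl e = e

  at-after-middle : ∀ q → Y at suc (3 * m + (2 + q)) ≡ After.triples (suc m +_) (h ∸ m) (halt ∷ []) at suc q
  at-after-middle q = Before.at-rest suc m _ (2 + q)

  pφ-after : ∀ u → pφ (suc m + u) ≡ 3 * m + (2 + 3 * u)
  pφ-after u = trans (pφ-> (s≤s (m≤m+n m u))) (trans (3*suc∸1 (m + u)) (shape m u))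
    where
    shape : ∀ m u → suc (suc (3 * (m + u))) ≡ 3 * m + (2 + 3 * u)
    shape = solve-∀

  pφ-after-suc : ∀ u → pφ (suc (suc m + u)) ≡ 3 + pφ (suc m + u)
  pφ-after-suc u = trans (pφ-> (s≤s (m≤n⇒m≤1+n (m≤m+n m u))))
    (trans (3*suc∸1 (suc m + u)) (trans (shape m u) (cong (3 +_) (sym (pφ-after u)))))
    where
    shape : ∀ m u → suc (suc (3 * (suc m + u))) ≡ 3 + (3 * m + (2 + 3 * u))
    shape = solve-∀

  u<h∸m : ∀ {u} → suc (suc m + u) ≤ suc h → u < h ∸ m
  u<h∸m {u} (s≤s le) = subst (_≤ h ∸ m) (m+n∸m≡n m (suc u)) (∸-monoˡ-≤ m (subst (_≤ h) (sym (+-suc m u)) le))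

  OddBlock : ℕ → Set
  OddBlock = Block Y pφ (ρ ∘ ia) (ρ ∘ ib)

  block-before : ∀ {t} → t < m → OddBlock (suc t)
  block-before {t} t<m = double first second (trans (pφ-≤ t<m) (trans (*-suc 3 t) (cong (3 +_) (sym pφt))))
    where
    pφt : pφ t ≡ 3 * t
    pφt = pφ-≤ (<⇒≤ t<m)
    first : Y at suc (pφ t) ≡ just (neg (r (ρ (ia (suc t)))))
    first = at-cong (cong suc pφt) (cong (neg ∘ r ∘ ρ) (ia-≤ (s≤s (<⇒≤ t<m)))) (Before.at-fst suc m _ t<m)
    second : Y at suc (suc (pφ t)) ≡ just (pos (r (ρ (ib (suc t)))))
    second = at-cong (cong (suc ∘ suc) pφt) (cong (pos ∘ r ∘ ρ) (ib-≤ t<m)) (Before.at-snd suc m _ t<m)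

  block-middle : OddBlock (suc m)
  block-middle = single first (cong ρ (trans (ib-> (n<1+n m)) (sym (ia-≤ ≤-refl))))
    (trans (pφ-> (n<1+n m)) (trans (3*suc∸1 m) (cong (2 +_) (sym pφm))))
    where
    pφm : pφ m ≡ 3 * m
    pφm = pφ-≤ ≤-refl
    first : Y at suc (pφ m) ≡ just (pos (r (ρ (ia (suc m)))))
    first = at-cong (cong suc (trans pφm (sym (+-identityʳ _)))) (cong (pos ∘ r ∘ ρ) (trans (ia-≤ ≤-refl) (2*suc∸1 m)))
      (Before.at-rest suc m _ 0)

  block-after : ∀ {u} → u < h ∸ m → OddBlock (suc (suc m + u))
  block-after {u} u< = double first second (pφ-after-suc u)
    where
    first : Y at suc (pφ (suc m + u)) ≡ just (neg (r (ρ (ia (suc (suc m + u))))))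
    first = at-cong (cong suc (pφ-after u))
      (cong (neg ∘ r ∘ ρ) (trans (ia-> (s≤s (s≤s (m≤m+n m u)))) (2*suc∸2 (suc m + u))))
      (trans (at-after-middle (3 * u)) (After.at-fst (suc m +_) (h ∸ m) _ u<))
    second : Y at suc (suc (pφ (suc m + u))) ≡ just (pos (r (ρ (ib (suc (suc m + u))))))
    second = at-cong (cong suc (trans (cong suc (pφ-after u)) (sym (+-suc (3 * m) (2 + 3 * u)))))
      (cong (pos ∘ r ∘ ρ) (trans (ib-> (s≤s (m≤n⇒m≤1+n (m≤m+n m u)))) (2*suc∸1 (suc m + u))))
      (trans (at-after-middle (suc (3 * u))) (After.at-snd (suc m +_) (h ∸ m) _ u<))

  block : ∀ {j} → 1 ≤ j → j ≤ suc h → OddBlock j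
  block 1≤j j≤ with region m 1≤j
  ... | before t<m = block-before t<m
  ... | middle     = block-middle
  ... | after u    = block-after (u<h∸m j≤)

  halts : Y at start pφ (suc (suc h)) ≡ just halt
  halts = at-cong (cong suc position) refl
    (trans (at-after-middle _) (After.at-rest (suc m +_) (h ∸ m) _ 0))
    where
    position : pφ (suc h) ≡ 3 * m + (2 + (3 * (h ∸ m) + 0))
    position = begin
      pφ (suc h)                       ≡⟨ cong (pφ ∘ suc) (sym (m+[n∸m]≡n m≤h)) ⟩
      pφ (suc m + (h ∸ m))             ≡⟨ pφ-after (h ∸ m) ⟩
      3 * m + (2 + 3 * (h ∸ m))        ≡⟨ cong (λ x → 3 * m + (2 + x)) (sym (+-identityʳ _)) ⟩
      3 * m + (2 + (3 * (h ∸ m) + 0))  ∎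
      where open ≡-Reasoning

  skeleton : Skeleton Y
  skeleton = record
    { blocks = suc h ; pφ = pφ ; ra = ρ ∘ ia ; rb = ρ ∘ ib
    ; pφ-zero = pφ-≤ z≤n ; block = block ; halts = halts
    }

  φ-at : ∀ {j u} → 1 ≤ j → j ≤ suc h → φ j ≡ u → Y at pφ j ≡ just u
  φ-at 1≤j j≤ φj with region m 1≤j
  ... | before {t} t<m = at-cong (trans (pφ-≤ t<m) (*-suc 3 t)) (sym φj) (Before.at-thd suc m _ t<m)
  ... | middle = at-cong (trans (pφ-> (n<1+n m)) (trans (3*suc∸1 m) (cong suc (+-comm 1 (3 * m)))))
                         (sym φj) (Before.at-rest suc m _ 1)
  ... | after u = at-cong (trans (pφ-after-suc u) (trans (cong (3 +_) (pφ-after u)) (shape m u))) (sym φj)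
                          (trans (at-after-middle _) (After.at-thd (suc m +_) (h ∸ m) _ (u<h∸m j≤)))
    where
    shape : ∀ m u → 3 + (3 * m + (2 + 3 * u)) ≡ suc (3 * m + (2 + suc (suc (3 * u))))
    shape = solve-∀

  pφ-crossing : ∀ {j k} → 1 ≤ k → j ≤ m → m < j + k → pφ j + (3 * k ∸ 1) ≡ pφ (j + k)
  pφ-crossing {j} {k} 1≤k j≤m m<j+k = begin
    pφ j + (3 * k ∸ 1)  ≡⟨ cong (_+ (3 * k ∸ 1)) (pφ-≤ j≤m) ⟩
    3 * j + (3 * k ∸ 1) ≡⟨ sym (+-∸-assoc (3 * j) (≤-trans 1≤k (m≤m+n k _))) ⟩
    3 * j + 3 * k ∸ 1   ≡⟨ cong (_∸ 1) (sym (*-distribˡ-+ 3 j k)) ⟩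
    3 * (j + k) ∸ 1     ≡⟨ sym (pφ-> m<j+k) ⟩
    pφ (j + k)          ∎
    where open ≡-Reasoning

  pφ-uncrossed : ∀ {j k} → 1 ≤ j → ¬ (j ≤ m × m < j + k) → pφ j + 3 * k ≡ pφ (j + k)
  pφ-uncrossed {j} {k} 1≤j uncrossed with ≤-<-connex j m
  ... | inj₁ j≤m = begin
    pφ j + 3 * k    ≡⟨ cong (_+ 3 * k) (pφ-≤ j≤m) ⟩
    3 * j + 3 * k   ≡⟨ sym (*-distribˡ-+ 3 j k) ⟩
    3 * (j + k)     ≡⟨ sym (pφ-≤ (≮⇒≥ λ m<j+k → uncrossed (j≤m , m<j+k))) ⟩
    pφ (j + k)      ∎
    where open ≡-Reasoning
  ... | inj₂ m<j = begin
    pφ j + 3 * k         ≡⟨ cong (_+ 3 * k) (pφ-> m<j) ⟩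
    3 * j ∸ 1 + 3 * k    ≡⟨ sym (+-∸-comm (3 * k) (≤-trans 1≤j (m≤m+n j _))) ⟩
    3 * j + 3 * k ∸ 1    ≡⟨ cong (_∸ 1) (sym (*-distribˡ-+ 3 j k)) ⟩
    3 * (j + k) ∸ 1      ≡⟨ sym (pφ-> (≤-trans m<j (m≤m+n j k))) ⟩
    pφ (j + k)           ∎
    where open ≡-Reasoning

  tail : LastOK (φ (suc h)) → ∀ {j} → 1 ≤ j → j ≤ suc h → PhiOddOK h m j (φ j) → Tail skeleton j
  tail last {j} 1≤j j≤ (inj₁ (suc y , 1≤k , k≤ , (j≤m , m<j+k) , φj)) =
    jumps (φ-at 1≤j j≤ φj) (subst (1 ≤_) (sym (3*suc∸1 y)) (s≤s z≤n)) (pφ-crossing 1≤k j≤m m<j+k)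
          (m<m+n j 1≤k) (+-≤-∸ j≤ k≤)
  tail last {j} 1≤j j≤ (inj₂ (inj₁ (k , 1≤k , k≤ , uncrossed , φj))) =
    jumps (φ-at 1≤j j≤ φj) (≤-trans 1≤k (m≤m+n k _)) (pφ-uncrossed 1≤j uncrossed)
          (m<m+n j 1≤k) (+-≤-∸ j≤ k≤)
  tail last 1≤j j≤ (inj₂ (inj₂ (inj₁ φj)))         = sets-plain (φ-at 1≤j j≤ φj)
  tail last 1≤j j≤ (inj₂ (inj₂ (inj₂ (inj₁ φj))))  = sets-pos (φ-at 1≤j j≤ φj)
  tail last 1≤j j≤ (inj₂ (inj₂ (inj₂ (inj₂ φj))))  = sets-neg (φ-at 1≤j j≤ φj) (below-last {φ} j≤ last φj)

  Index : ℕ → Set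
  Index i = 1 ≤ i × i ≤ suc (2 * h)

  odd-index : ∀ {i x} → i ≡ suc (2 * x) → x ≤ h → Index i
  odd-index refl x≤h = s≤s z≤n , s≤s (*-monoʳ-≤ 2 x≤h)

  even-index : ∀ {i x} → i ≡ 2 * x → 1 ≤ x → x ≤ h → Index i
  even-index refl 1≤x x≤h = ≤-trans 1≤x (m≤m+n _ _) , m≤n⇒m≤1+n (*-monoʳ-≤ 2 x≤h)

  index-ranges : ∀ {j} → 1 ≤ j → j ≤ suc h → Index (ia j) × Index (ib j)
  index-ranges 1≤j j≤ with region m 1≤j
  ... | before {t} t<m = odd-index (trans (ia-≤ (s≤s (<⇒≤ t<m))) (2*suc∸1 t)) (≤-trans (<⇒≤ t<m) m≤h) ,
                         even-index (ib-≤ t<m) (s≤s z≤n) (≤-trans t<m m≤h)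
  ... | middle = odd-index (trans (ia-≤ ≤-refl) (2*suc∸1 m)) m≤h ,
                 odd-index (trans (ib-> (n<1+n m)) (2*suc∸1 m)) m≤h
  ... | after u = even-index (trans (ia-> (s≤s (s≤s (m≤m+n m u)))) (2*suc∸2 (suc m + u))) (s≤s z≤n) (≤-pred j≤) ,
                  odd-index (trans (ib-> (s≤s (m≤n⇒m≤1+n (m≤m+n m u)))) (2*suc∸1 (suc m + u))) (≤-pred j≤)

  covers-indices : ∀ {i} → 1 ≤ i → i ≤ suc (2 * h) → ∃ λ j → 1 ≤ j × j ≤ suc h × (ia j ≡ i ⊎ ib j ≡ i)
  covers-indices {i} 1≤i i≤ with even⊎odd i
  ... | zero  , inj₁ refl = contradiction 1≤i λ ()
  ... | suc q , inj₁ refl with ≤-<-connex (suc q) m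
  ...   | inj₁ q<m = suc q , s≤s z≤n , ≤-trans q<m (m≤n⇒m≤1+n m≤h) , inj₂ (ib-≤ q<m)
  ...   | inj₂ m≤q = suc (suc q) , s≤s z≤n ,
                     *-cancelˡ-< 2 (suc q) (suc h) (≤-trans (s≤s i≤) (≤-reflexive (sym (*-suc 2 h)))) ,
                     inj₁ (trans (ia-> (s≤s m≤q)) (2*suc∸2 (suc q)))
  covers-indices {i} 1≤i i≤ | q , inj₂ refl with ≤-<-connex q m
  ...   | inj₁ q≤m = suc q , s≤s z≤n , s≤s (≤-trans q≤m m≤h) , inj₁ (trans (ia-≤ (s≤s q≤m)) (2*suc∸1 q))
  ...   | inj₂ m<q = suc q , s≤s z≤n , s≤s (*-cancelˡ-≤ 2 (≤-pred i≤)) ,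
                     inj₂ (trans (ib-> (m≤n⇒m≤1+n m<q)) (2*suc∸1 q))

  layout : BijOn (suc (2 * h)) ρ → (∀ j → 1 ≤ j → j ≤ suc h → PhiOddOK h m j (φ j)) → LastOK (φ (suc h)) →
           Layout (suc (2 * h)) Y
  layout bij φ-ok last = record
    { skeleton = skeleton
    ; tails    = λ 1≤j j≤ → tail last 1≤j j≤ (φ-ok _ 1≤j j≤)
    ; covering = covering-by-indices skeleton bij ia ib (λ _ → refl) (λ _ → refl) index-ranges covers-indices
    }

inC-layout : ∀ {n Y} → InC n Y → Layout n Y
inC-layout (inj₁ (h , refl , ρ , φ , bij , φ-ok , last , refl)) = EvenLayout.layout h ρ φ bij φ-ok last
inC-layout (inj₂ (h , refl , m , ρ , φ , m≤h , bij , φ-ok , last , refl)) = OddLayout.layout h m ρ φ m≤h bij φ-ok last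

-- Programs reading one register twice

replaceAt-at-≢ : ∀ X l v {p} → p ≢ l → replaceAt X l v at p ≡ X at p
replaceAt-at-≢ []      l             v         _  = refl
replaceAt-at-≢ (u ∷ X) zero          v         _  = refl
replaceAt-at-≢ (u ∷ X) (suc zero)    v {zero}        _  = refl
replaceAt-at-≢ (u ∷ X) (suc zero)    v {suc zero}    p≢l = contradiction refl p≢l
replaceAt-at-≢ (u ∷ X) (suc zero)    v {suc (suc p)} _  = refl
replaceAt-at-≢ (u ∷ X) (suc (suc l)) v {zero}        _  = refl
replaceAt-at-≢ (u ∷ X) (suc (suc l)) v {suc zero}    _  = refl
replaceAt-at-≢ (u ∷ X) (suc (suc l)) v {suc (suc p)} p≢l = replaceAt-at-≢ X (suc l) v (p≢l ∘ cong suc)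

replaceAt-at-≡ : ∀ X {l v u} → X at l ≡ just u → replaceAt X l v at l ≡ just v
replaceAt-at-≡ (x ∷ X) {suc zero}    _ = refl
replaceAt-at-≡ (x ∷ X) {suc (suc l)} e = replaceAt-at-≡ X e

at-position : ∀ X {p u} → X at p ≡ just u → 1 ≤ p
at-position (x ∷ X) {suc p} _ = s≤s z≤n

neg-reads : ∀ {X p i a} → ReadsAt X p i → X at p ≡ just (neg (inGet a)) → a ≡ i
neg-reads (inj₁ x) y with () ← trans (sym y) x
neg-reads (inj₂ x) y with refl ← trans (sym y) x = refl

pos-reads : ∀ {X p i a} → ReadsAt X p i → X at p ≡ just (pos (inGet a)) → a ≡ i
pos-reads (inj₁ x) y with refl ← trans (sym y) x = refl
pos-reads (inj₂ x) y with () ← trans (sym y) x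

tail-¬reads : ∀ {X} {S : Skeleton X} {j i} → Tail S j → ¬ ReadsAt X (Skeleton.pφ S j) i
tail-¬reads (sets-plain x)       (inj₁ y) with () ← trans (sym x) y
tail-¬reads (sets-plain x)       (inj₂ y) with () ← trans (sym x) y
tail-¬reads (sets-pos x)         (inj₁ y) with () ← trans (sym x) y
tail-¬reads (sets-pos x)         (inj₂ y) with () ← trans (sym x) y
tail-¬reads (sets-neg x _)       (inj₁ y) with () ← trans (sym x) y
tail-¬reads (sets-neg x _)       (inj₂ y) with () ← trans (sym x) y
tail-¬reads (jumps x _ _ _ _)    (inj₁ y) with () ← trans (sym x) y
tail-¬reads (jumps x _ _ _ _)    (inj₂ y) with () ← trans (sym x) y

between-suc : ∀ {a k} → a ≤ k → k ≤ suc a → k ≡ a ⊎ k ≡ suc a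
between-suc a≤k k≤ with m≤n⇒m<n∨m≡n k≤
... | inj₁ (s≤s k≤a) = inj₁ (≤-antisym k≤a a≤k)
... | inj₂ k≡        = inj₂ k≡

module Duplicate {n : ℕ} (X : List Prim) {i k l : ℕ} (k≢l : k ≢ l) (read-k : ReadsAt X k i)
                 (unreachable : ∀ p → p ≤ k + 2 → ¬ Chain X p l) (guard : X at l ≡ just (pos (inGet i)))
                 (L : Layout n (replaceAt X l (jump 2))) where

  Y : List Prim
  Y = replaceAt X l (jump 2)

  open Layout L
  open Skeleton skeleton

  Y-l : Y at l ≡ just (jump 2)
  Y-l = replaceAt-at-≡ X guard

  agrees : ∀ {p w} → Y at p ≡ just w → w ≢ jump 2 → X at p ≡ just w
  agrees {p} y w≢ with p ≟ l
  ... | yes refl = contradiction (just-injective (trans (sym y) Y-l)) w≢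
  ... | no  p≢l  = trans (sym (replaceAt-at-≢ X l _ p≢l)) y

  read-kY : ReadsAt Y k i
  read-kY = Data.Sum.map (trans (replaceAt-at-≢ X l _ k≢l)) (trans (replaceAt-at-≢ X l _ k≢l)) read-k

  blockX : ∀ {j} → Block Y pφ ra rb j → Block X pφ ra rb j
  blockX (double x y eq) = double (agrees x λ ()) (agrees y λ ()) eq
  blockX (single x rb≡ra eq) = single (agrees x λ ()) rb≡ra eq

  skeletonX : Skeleton X
  skeletonX = record
    { blocks = blocks ; pφ = pφ ; ra = ra ; rb = rb ; pφ-zero = pφ-zero
    ; block = λ 1≤j j≤ → blockX (block 1≤j j≤) ; halts = agrees halts λ ()
    }

  coveringX : Covering skeletonX n
  coveringX = record { Covering covering }

  tailX : ∀ {j} → pφ j ≢ l → Tail skeleton j → Tail skeletonX j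
  tailX pφj≢l (sets-plain x)           = sets-plain (trans (sym (replaceAt-at-≢ X l _ pφj≢l)) x)
  tailX pφj≢l (sets-pos x)             = sets-pos (trans (sym (replaceAt-at-≢ X l _ pφj≢l)) x)
  tailX pφj≢l (sets-neg x j<b)         = sets-neg (trans (sym (replaceAt-at-≢ X l _ pφj≢l)) x) j<b
  tailX pφj≢l (jumps x 1≤L eq j<j' j'≤) = jumps (trans (sym (replaceAt-at-≢ X l _ pφj≢l)) x) 1≤L eq j<j' j'≤

  reads-k-at : ∀ {p} → k ≡ p → ReadsAt Y p i
  reads-k-at refl = read-kY

  reads-within-block : ∀ {j} → 1 ≤ j → j ≤ blocks → start pφ j ≤ k → k ≤ pφ j → ra j ≡ i ⊎ rb j ≡ i
  reads-within-block 1≤j j≤ start≤k k≤pφ with m≤n⇒m<n∨m≡n k≤pφ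
  ... | inj₂ k≡pφ = contradiction (reads-k-at k≡pφ) (tail-¬reads (tails 1≤j j≤))
  ... | inj₁ k<pφ with block 1≤j j≤
  ...   | single x _ eq = inj₁ (pos-reads {Y} (reads-k-at (≤-antisym (≤-pred (≤-trans k<pφ (≤-reflexive eq))) start≤k)) x)
  ...   | double x y eq with between-suc start≤k (≤-pred (≤-trans k<pφ (≤-reflexive eq)))
  ...     | inj₁ k≡ = inj₁ (neg-reads {Y} (reads-k-at k≡) x)
  ...     | inj₂ k≡ = inj₂ (pos-reads {Y} (reads-k-at k≡) y)

  1≤k : 1 ≤ k
  1≤k = [ at-position X , at-position X ] read-k

  Y-at-pφ : ∀ {j} → pφ j ≡ l → Y at pφ j ≡ just (jump 2)
  Y-at-pφ pφj≡l = subst (λ p → Y at p ≡ just (jump 2)) (sym pφj≡l) Y-l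

  module Invariant (I : ℕ → Bool) where

    SetOrAvoids : ℕ → Bool → Set
    SetOrAvoids j b = I i ≡ true → b ≡ true ⊎ ¬ Chain X (pφ j) l

    SetOrBefore : ℕ → Bool → Set
    SetOrBefore j b = I i ≡ true → b ≡ true ⊎ start pφ j ≤ k

    open Execution skeletonX I SetOrAvoids SetOrBefore
    open Firing skeletonX I using (Fires)

    guarded-exit : ∀ {j} → pφ j ≡ l → Tail skeleton j → Exit j
    guarded-exit {j} pφj≡l (jumps x 1≤L eq j<j' j'≤) with refl ← just-injective (trans (sym x) (Y-at-pφ pφj≡l)) =
      guarded (subst (λ p → X at p ≡ just (pos (inGet i))) (sym pφj≡l) guard) (≤-trans j<j' j'≤)
              (pφ-tight j<j' j'≤ eq) set-already λ i₀ _ i₁ → contradiction (trans (sym i₀) i₁) λ ()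
      where
      set-already : I i ≡ true → ∀ {b} → SetOrAvoids j b → b ≡ true
      set-already t p = [ id , (λ avoids → contradiction (subst (Chain X (pφ j)) pφj≡l chain-refl) avoids) ] (p t)
    guarded-exit pφj≡l (sets-plain x) with () ← trans (sym x) (Y-at-pφ pφj≡l)
    guarded-exit pφj≡l (sets-pos x)   with () ← trans (sym x) (Y-at-pφ pφj≡l)
    guarded-exit pφj≡l (sets-neg x _) with () ← trans (sym x) (Y-at-pφ pφj≡l)

    exit : ∀ {j} → 1 ≤ j → j ≤ blocks → Exit j
    exit {j} 1≤j j≤ with pφ j ≟ l
    ... | no  pφj≢l = tail (tailX pφj≢l (tails 1≤j j≤))
    ... | yes pφj≡l = guarded-exit pφj≡l (tails 1≤j j≤)

    jump-preserves : ∀ {j L j' b} → X at pφ j ≡ just (jump L) → 1 ≤ L → pφ j + L ≡ pφ j' →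
                     SetOrAvoids j b → SetOrAvoids j' b
    jump-preserves x 1≤L eq p t =
      Data.Sum.map₂ (λ avoids chain → avoids (chain-step x 1≤L (subst (λ q → Chain X q l) (sym eq) chain))) (p t)

    enter : ∀ {j b} → 1 ≤ j → j ≤ blocks → Fires j → SetOrBefore j b → SetOrAvoids j b
    enter 1≤j j≤ _ p t = Data.Sum.map₂ (λ start≤k → unreachable _ (≤-trans (pφ≤2+start 1≤j j≤)
      (≤-trans (+-monoʳ-≤ 2 start≤k) (≤-reflexive (+-comm 2 k))))) (p t)

    pass : ∀ {j b} → 1 ≤ j → j ≤ blocks → I (ra j) ≡ false → I (rb j) ≡ false →
           SetOrBefore j b → SetOrBefore (suc j) b
    pass {j} 1≤j j≤ a₀ b₀ p t with p t
    ... | inj₁ b≡ = inj₁ b≡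
    ... | inj₂ start≤k with ≤-<-connex k (pφ j)
    ...   | inj₂ pφ<k = inj₂ pφ<k
    ...   | inj₁ k≤pφ with reads-within-block 1≤j j≤ start≤k k≤pφ
    ...     | inj₁ ra≡i = contradiction (trans (sym a₀) (trans (cong I ra≡i) t)) λ ()
    ...     | inj₂ rb≡i = contradiction (trans (sym b₀) (trans (cong I rb≡i) t)) λ ()

    open Run exit jump-preserves (λ _ _ → inj₁ refl) (λ _ _ → inj₁ refl) enter pass public

  detects : DetectsFiring skeletonX
  detects s o = runsFrom-one runs-from-one s (λ _ → refl) o λ _ → inj₂ (subst (λ z → suc z ≤ k) (sym pφ-zero) 1≤k)
    where
    open Invariant (inp s)
    open Execution skeletonX (inp s) SetOrAvoids SetOrBefore

theorem3 : ∀ (n : ℕ) (X : List Prim) → 1 ≤ n → IsIS X → InE n X →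
           Computes n X (tstnz n)
theorem3 n X _ _ (inj₁ (_ , inC)) = detects⇒computes skeleton covering (layout-detects L)
  where
  L : Layout n X
  L = inC-layout inC
  open Layout L
theorem3 n X _ _ (inj₂ (i , _ , _ , k , l , k≢l , read-k , read-l , unreachable , (i' , _ , guard) , inC))
  with refl ← pos-reads {X} read-l guard =
  detects⇒computes skeletonX coveringX detects
  where open Duplicate X k≢l read-k unreachable guard (inC-layout inC)
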